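{- In the theory $\mathsf{ATC}$ extended by the definition $Pxy \leftrightarrow \mathfrak{at}_{x}\preccurlyeq \mathfrak{at}_{y}$, the following formulas are provable (universally closed): $Pxx$; $Pxy \land Pyz \to Pxz$; $Pxy \land Pyx \to x=y$.
   Context: Language: two-sorted classical logic with individual variables $x,y,z,\dots$ and plural variables $xx,yy,zz,\dots$; identity $=$ between individual terms; the predicate $x\prec tt$ ("$x$ is one of $tt$") with an individual term on the left and a plural term on the right. Abbreviations: $tt\preccurlyeq ss := \forall z(z\prec tt\to z\prec ss)\land \exists x(x\prec tt)$; $tt\approx ss := \forall x(x\prec tt\leftrightarrow x\prec ss)$; restricted quantifiers $\forall_{z\prec tt}\varphi:=\forall z(z\prec tt\to\varphi)$, $\exists_{z\prec tt}\varphi:=\exists z(z\prec tt\land\varphi)$, $\forall_{yy\preccurlyeq tt}\varphi:=\forall yy(yy\preccurlyeq tt\to\varphi)$, $\exists_{yy\preccurlyeq tt}\varphi:=\exists yy(yy\preccurlyeq tt\land\varphi)$. No plural comprehension schema is assumed and plurals may be empty. The theory $\mathsf{ATC}$ has a single non-logical primitive $F$, written $F_{tt}x$ ("$x$ is a composition of $tt$"), with $tt$ a plural term and $x$ individual. Plural terms: plural variables, a constant $aa$, and $\mathfrak{at}_{tt}$ for plural terms $tt$. Axioms of $\mathsf{ATC}$ (universally closed): (Df.$aa_F$) $x\prec aa\leftrightarrow \forall yy\,\forall_{z\prec yy}(F_{yy}x\to z=x)$; (Df.$\mathfrak{at}^{pl}_F$) $x\prec \mathfrak{at}_{zz}\leftrightarrow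 \exists_{y\prec zz}\exists_{yy\preccurlyeq aa}(F_{yy}y\land x\prec yy)$; (ATC1) $\forall x\,\exists_{zz\preccurlyeq aa}\big(F_{zz}x\land \forall_{yy\preccurlyeq aa}(F_{yy}x\leftrightarrow zz\approx yy)\land\forall y(F_{zz}y\to x=y)\big)$; (ATC2) $F_{zz}x\leftrightarrow F_{\mathfrak{at}_{zz}}x$. Since by (ATC1) each $x$ determines a unique such plurality, $\mathsf{ATC}$ is extended by a plural term $\mathfrak{at}_x$ for each individual term $x$, characterized by $\mathfrak{at}_{x}\preccurlyeq aa \land F_{\mathfrak{at}_{x}}x \land \forall_{yy\preccurlyeq aa}(F_{yy}x\leftrightarrow yy\approx\mathfrak{at}_{x})\land \forall y (F_{\mathfrak{at}_{x}}y\to x=y)$. -}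

module Defs where

open import Data.Product using (Σ; ∃; _×_; _,_)
open import Relation.Binary.PropositionalEquality using (_≡_)
open import Function.Bundles using (_⇔_)

-- A (classical, set-valued) model of the two-sorted language of ATC,
-- extended by the plural terms at_x for individual terms x.
-- Individuals live in Ind, pluralities in Pl (pluralities may be empty;
-- no comprehension, no extensionality assumed).
record ATC : Set₁ where
  field
    Ind : Set
    Pl  : Set
    _≺_ : Ind → Pl → Set               -- x ≺ tt : "x is one of tt"
    F   : Pl → Ind → Set               -- F tt x : "x is a composition of tt"
    aa  : Pl
    atP : Pl → Pl
    atI : Ind → Pl

  _≼_ : Pl → Pl → Set
  tt ≼ ss = (∀ z → z ≺ tt → z ≺ ss) × ∃ λ x → x ≺ tt

  _≈_ : Pl → Pl → Set
  tt ≈ ss = ∀ x → (x ≺ tt) ⇔ (x ≺ ss)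

  field
    Df-aa : ∀ x → (x ≺ aa) ⇔ (∀ yy → ∀ z → z ≺ yy → F yy x → z ≡ x)
    Df-at : ∀ zz x → (x ≺ atP zz) ⇔
              (∃ λ y → y ≺ zz × (Σ Pl λ yy → yy ≼ aa × F yy y × x ≺ yy))
    ATC1 : ∀ x → Σ Pl λ zz → zz ≼ aa × F zz x
             × (∀ yy → yy ≼ aa → (F yy x ⇔ (zz ≈ yy)))
             × (∀ y → F zz y → x ≡ y)
    ATC2 : ∀ zz x → F zz x ⇔ F (atP zz) x
    Df-atI : ∀ x → atI x ≼ aa × F (atI x) x
               × (∀ yy → yy ≼ aa → (F yy x ⇔ (yy ≈ atI x)))
               × (∀ y → F (atI x) y → x ≡ y)

  P : Ind → Ind → Set
  P x y = atI x ≼ atI y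

-- Reflexivity and transitivity of P are those of ≼, since at_x is nonempty.
-- For antisymmetry, mutual inclusion makes at_y coextensive with at_x; as
-- at_y ≼ aa, the characterization of at_x then yields F at_y x, and at_y
-- composes nothing but y.
module Submission where

open import Defs
open import Data.Product using (∃; _×_; _,_; proj₁; proj₂)
open import Relation.Binary.PropositionalEquality using (_≡_; sym)
open import Level using (0ℓ)
open import Axiom.ExcludedMiddle using (ExcludedMiddle)
open import Function.Bundles using (mk⇔; Equivalence)

module Parthood (M : ATC) where
  open ATC M

  ≼-refl : ∀ {tt} → ∃ (λ x → x ≺ tt) → tt ≼ tt
  ≼-refl ne = (λ _ z≺tt → z≺tt) , ne

  ≼-trans : ∀ {tt ss uu} → tt ≼ ss → ss ≼ uu → tt ≼ uu
  ≼-trans (tt⊆ss , ne) (ss⊆uu , _) = (λ z z≺tt → ss⊆uu z (tt⊆ss z z≺tt)) , ne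

  ≼-antisym-≈ : ∀ {tt ss} → tt ≼ ss → ss ≼ tt → tt ≈ ss
  ≼-antisym-≈ (tt⊆ss , _) (ss⊆tt , _) z = mk⇔ (tt⊆ss z) (ss⊆tt z)

  atI-nonempty : ∀ x → ∃ λ z → z ≺ atI x
  atI-nonempty x = proj₂ (proj₁ (Df-atI x))

  atI-injective-≈ : ∀ {x y} → atI y ≈ atI x → x ≡ y
  atI-injective-≈ {x} {y} aty≈atx with Df-atI x | Df-atI y
  ... | _ , _ , F⇔≈atx , _ | aty≼aa , _ , _ , onlyComposesY =
    sym (onlyComposesY x (Equivalence.from (F⇔≈atx (atI y) aty≼aa) aty≈atx))

  P-refl : ∀ x → P x x
  P-refl x = ≼-refl (atI-nonempty x)

  P-trans : ∀ x y z → P x y → P y z → P x z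
  P-trans _ _ _ = ≼-trans

  P-antisym : ∀ x y → P x y → P y x → x ≡ y
  P-antisym _ _ Pxy Pyx = atI-injective-≈ (≼-antisym-≈ Pyx Pxy)

lemma1 : ExcludedMiddle 0ℓ → (M : ATC) →
    let open ATC M in
    (∀ x → P x x)
    × (∀ x y z → P x y → P y z → P x z)
    × (∀ x y → P x y → P y x → x ≡ y)
lemma1 _ M = P-refl , P-trans , P-antisym
  where open Parthood M
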